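{- Let $G$ and $H$ be finite simple graphs with $G\in\mathfrak{F}$. Then $\gamma_R(G\Box H)\ge \gamma(G)\gamma_R(H)$.
   Context: $\gamma(X)$ denotes the domination number of a graph $X$ (minimum size of a set $D$ such that every vertex outside $D$ has a neighbor in $D$). A Roman dominating function on $X$ is a map $f:V(X)\to\{0,1,2\}$ such that every vertex $v$ with $f(v)=0$ has a neighbor $u$ with $f(u)=2$; $\gamma_R(X)$ is the minimum of $\sum_v f(v)$ over such $f$. $\mathfrak{F}$ is the class of graphs $G$ having a dominating set $S=\{u_1,\dots,u_{\gamma(G)}\}$ of size $\gamma(G)$ with $N[u_i]\cap N[u_j]=\emptyset$ for all $i\ne j$ (an efficient dominating set), where $N[u]$ is the closed neighborhood of $u$. The Cartesian product $G\Box H$ has vertex set $V(G)\times V(H)$, with $(g,h)\sim(g',h')$ iff ($g=g'$ and $h\sim h'$) or ($g\sim g'$ and $h=h'$). -}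

module Defs where

open import Data.Nat using (ℕ; _≤_; _+_)
open import Data.Fin using (Fin; remQuot)
open import Data.Fin.Subset using (Subset; _∈_; ∣_∣)
open import Data.Product using (_×_; _,_; ∃; Σ; proj₁; proj₂)
open import Data.Sum using (_⊎_)
open import Data.Vec using (tabulate; sum)
open import Relation.Nullary using (¬_)
open import Relation.Binary.PropositionalEquality using (_≡_)
import Relation.Binary.PropositionalEquality
import Data.Sum

record Graph : Set₁ where
  field
    n     : ℕ
    Adj   : Fin n → Fin n → Set
    sym   : ∀ {u v} → Adj u v → Adj v u
    irrefl : ∀ {u} → ¬ Adj u u
open Graph public

InN : (G : Graph) → Fin (n G) → Fin (n G) → Set
InN G u w = (w ≡ u) ⊎ Adj G u w

IsDominating : (G : Graph) → Subset (n G) → Set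
IsDominating G D = ∀ v → ¬ (v ∈ D) → ∃ λ u → (u ∈ D) × Adj G v u

IsDomNum : Graph → ℕ → Set
IsDomNum G k =
  (∃ λ D → IsDominating G D × ∣ D ∣ ≡ k) ×
  (∀ D → IsDominating G D → k ≤ ∣ D ∣)

val : Fin 3 → ℕ
val Fin.zero = 0
val (Fin.suc Fin.zero) = 1
val (Fin.suc (Fin.suc Fin.zero)) = 2

IsRomanDF : (G : Graph) → (Fin (n G) → Fin 3) → Set
IsRomanDF G f = ∀ v → val (f v) ≡ 0 → ∃ λ u → Adj G v u × val (f u) ≡ 2

weight : (G : Graph) → (Fin (n G) → Fin 3) → ℕ
weight G f = sum (tabulate (λ v → val (f v)))

IsRomanDomNum : Graph → ℕ → Set
IsRomanDomNum G r =
  (∃ λ f → IsRomanDF G f × weight G f ≡ r) ×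
  (∀ f → IsRomanDF G f → r ≤ weight G f)

InFrakF : Graph → Set
InFrakF G = ∃ λ k → IsDomNum G k × ∃ λ S → IsDominating G S × ∣ S ∣ ≡ k ×
  (∀ u v → u ∈ S → v ∈ S → ¬ (u ≡ v) → ∀ w → ¬ (InN G u w × InN G v w))

-- Cartesian product G □ H (vertex p corresponds to (fstV p , sndV p); remQuot is a bijection) on Fin (n G * n H), vertex p ↔ remQuot p = (g , h)
-- first / second coordinate of a product vertex
fstV : (G H : Graph) → Fin (n G Data.Nat.* n H) → Fin (n G)
fstV G H p = proj₁ (remQuot {n G} (n H) p)

sndV : (G H : Graph) → Fin (n G Data.Nat.* n H) → Fin (n H)
sndV G H p = proj₂ (remQuot {n G} (n H) p)

□-Adj : (G H : Graph) → Fin (n G Data.Nat.* n H) → Fin (n G Data.Nat.* n H) → Set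
□-Adj G H p q =
  ((fstV G H p ≡ fstV G H q) × Adj H (sndV G H p) (sndV G H q))
  ⊎ (Adj G (fstV G H p) (fstV G H q) × (sndV G H p ≡ sndV G H q))

□-sym : (G H : Graph) → ∀ {p q} → □-Adj G H p q → □-Adj G H q p
□-sym G H (Data.Sum.inj₁ (e , x)) = Data.Sum.inj₁ (Relation.Binary.PropositionalEquality.sym e , sym H x)
□-sym G H (Data.Sum.inj₂ (x , e)) = Data.Sum.inj₂ (sym G x , Relation.Binary.PropositionalEquality.sym e)

□-irrefl : (G H : Graph) → ∀ {p} → ¬ □-Adj G H p p
□-irrefl G H (Data.Sum.inj₁ (_ , x)) = irrefl H x
□-irrefl G H (Data.Sum.inj₂ (x , _)) = irrefl G x

_□_ : Graph → Graph → Graph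
G □ H = record
  { n = n G Data.Nat.* n H
  ; Adj = □-Adj G H
  ; sym = □-sym G H
  ; irrefl = □-irrefl G H
  }

-- Let S be an efficient dominating set of G, so every vertex g of G lies in
-- the closed neighbourhood of exactly one u ∈ S, its dominator.  For a Roman
-- dominating function f of G □ H and u ∈ S, add up f over the G-layers of the
-- vertices dominated by u and truncate at 2.  This is a Roman dominating
-- function of H: a vertex h of value 0 forces f(u,h) = 0, and the 2-valued
-- neighbour of (u,h) cannot be some (g,h) with g ~ u, as g is dominated by u,
-- so it is some (u,h') with h ~ h'.  These |S| functions live on disjoint
-- parts of f, hence |S| γ_R(H) ≤ w(f) = γ_R(G □ H), while γ(G) ≤ |S|.
module Submission where

open import Defs
open import Data.Nat using (ℕ; _≤_; _*_; zero; suc; _+_; z≤n; s≤s)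
open import Data.Nat.Properties
  using (+-0-commutativeMonoid; +-assoc; +-identityʳ; +-mono-≤; *-monoˡ-≤;
         m≤m+n; m≤n+m; n≤0⇒n≡0; ≤-trans; module ≤-Reasoning)
open import Data.Bool using (if_then_else_)
open import Data.Fin using (Fin; zero; suc; combine; _↑ˡ_; _↑ʳ_)
open import Data.Fin.Properties using (_≟_; remQuot-combine; combine-remQuot)
open import Data.Fin.Subset using (Subset; _∈_; ∣_∣; inside; outside)
open import Data.Fin.Subset.Properties using (_∈?_)
open import Data.Vec using ([]; _∷_; here; there)
import Data.Vec as Vec
open import Data.Product using (_×_; _,_; ∃; ∃₂; proj₁; proj₂)
open import Data.Sum using (_⊎_; inj₁; inj₂)
open import Data.Empty using (⊥-elim)
open import Function using (_∘_)
open import Relation.Nullary using (¬_; yes; no; does)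
open import Relation.Nullary.Decidable using (dec-true)
open import Relation.Binary.PropositionalEquality using (_≡_; refl; cong; trans)
import Relation.Binary.PropositionalEquality as ≡
open import Algebra.Properties.CommutativeMonoid.Sum +-0-commutativeMonoid
  using (sum; sum-syntax; ∑-comm; sum-cong-≗; sum-replicate-zero)

sum-tabulate : ∀ {n} (f : Fin n → ℕ) → Vec.sum (Vec.tabulate f) ≡ sum f
sum-tabulate {zero}  f = refl
sum-tabulate {suc n} f = cong (f zero +_) (sum-tabulate (f ∘ suc))

≤-sum : ∀ {n} (f : Fin n → ℕ) i → f i ≤ sum f
≤-sum f zero    = m≤m+n _ _
≤-sum f (suc i) = ≤-trans (≤-sum (f ∘ suc) i) (m≤n+m _ _)

sum-mono-≤ : ∀ {n} {f g : Fin n → ℕ} → (∀ i → f i ≤ g i) → sum f ≤ sum g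
sum-mono-≤ {zero}  f≤g = z≤n
sum-mono-≤ {suc n} f≤g = +-mono-≤ (f≤g zero) (sum-mono-≤ (f≤g ∘ suc))

sum-↑ : ∀ m {n} (f : Fin (m + n) → ℕ) → sum f ≡ sum (f ∘ (_↑ˡ n)) + sum (f ∘ (m ↑ʳ_))
sum-↑ zero    f = refl
sum-↑ (suc m) {n} f = trans (cong (f zero +_) (sum-↑ m (f ∘ suc)))
  (≡.sym (+-assoc (f zero) (sum (f ∘ suc ∘ (_↑ˡ n))) (sum (f ∘ suc ∘ (m ↑ʳ_)))))

sum-combine : ∀ m {n} (f : Fin (m * n) → ℕ) → sum f ≡ ∑[ i < m ] ∑[ j < n ] f (combine i j)
sum-combine zero    f = refl
sum-combine (suc m) {n} f =
  trans (sum-↑ n f) (cong (sum (f ∘ (_↑ˡ m * n)) +_) (sum-combine m (f ∘ (n ↑ʳ_))))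

sum-indicator : ∀ {k} (a : Fin k) c → ∑[ u < k ] (if does (a ≟ u) then c else 0) ≡ c
sum-indicator {suc k} zero c = trans (cong (c +_) (sum-replicate-zero k)) (+-identityʳ c)
sum-indicator (suc a) c = sum-indicator a c

∣p∣*c≤sum : ∀ {n} (p : Subset n) {c} (W : Fin n → ℕ) → (∀ {u} → u ∈ p → c ≤ W u) →
            ∣ p ∣ * c ≤ sum W
∣p∣*c≤sum []            W c≤W = z≤n
∣p∣*c≤sum (inside  ∷ p) W c≤W = +-mono-≤ (c≤W here) (∣p∣*c≤sum p (W ∘ suc) (c≤W ∘ there))
∣p∣*c≤sum (outside ∷ p) W c≤W = ≤-trans (∣p∣*c≤sum p (W ∘ suc) (c≤W ∘ there)) (m≤n+m _ _)

fibreSum : ∀ {m k} → (Fin m → Fin k) → Fin k → (Fin m → ℕ) → ℕ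
fibreSum {m} π u F = ∑[ g < m ] (if does (π g ≟ u) then F g else 0)

≤-fibreSum : ∀ {m k} (π : Fin m → Fin k) (F : Fin m → ℕ) {g u} → π g ≡ u →
             F g ≤ fibreSum π u F
≤-fibreSum π F {g} {u} πg≡u with ≤-sum (λ g → if does (π g ≟ u) then F g else 0) g
... | le rewrite dec-true (π g ≟ u) πg≡u = le

sum-fibreSum : ∀ {m k} (π : Fin m → Fin k) (F : Fin m → ℕ) →
               ∑[ u < k ] fibreSum π u F ≡ sum F
sum-fibreSum π F = trans (∑-comm (λ u g → if does (π g ≟ u) then F g else 0))
  (sum-cong-≗ (λ g → sum-indicator (π g) (F g)))

clamp₂ : ℕ → Fin 3
clamp₂ zero          = zero
clamp₂ (suc zero)    = suc zero
clamp₂ (suc (suc _)) = suc (suc zero)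

val-clamp₂≤ : ∀ x → val (clamp₂ x) ≤ x
val-clamp₂≤ zero          = z≤n
val-clamp₂≤ (suc zero)    = s≤s z≤n
val-clamp₂≤ (suc (suc x)) = s≤s (s≤s z≤n)

val-clamp₂≡0 : ∀ x → val (clamp₂ x) ≡ 0 → x ≡ 0
val-clamp₂≡0 zero          _  = refl
val-clamp₂≡0 (suc zero)    ()
val-clamp₂≡0 (suc (suc x)) ()

val-clamp₂≡2 : ∀ x → 2 ≤ x → val (clamp₂ x) ≡ 2
val-clamp₂≡2 (suc (suc x)) _         = refl
val-clamp₂≡2 (suc zero)    (s≤s ())

ClosedNeighbourhoodsDisjoint : (G : Graph) → Subset (n G) → Set
ClosedNeighbourhoodsDisjoint G S =
  ∀ u v → u ∈ S → v ∈ S → ¬ (u ≡ v) → ∀ w → ¬ (InN G u w × InN G v w)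

module _ (G : Graph) {S : Subset (n G)} (dom : IsDominating G S) where

  dominator : ∀ g → ∃ λ u → u ∈ S × InN G u g
  dominator g with g ∈? S
  ... | yes g∈S = g , g∈S , inj₁ refl
  ... | no  g∉S with dom g g∉S
  ...   | u , u∈S , g~u = u , u∈S , inj₂ (sym G g~u)

  dominator-unique : ClosedNeighbourhoodsDisjoint G S →
                     ∀ {u g} → u ∈ S → InN G u g → proj₁ (dominator g) ≡ u
  dominator-unique disjoint {u} {g} u∈S u∋g with dominator g
  ... | v , v∈S , v∋g with v ≟ u
  ...   | yes v≡u = v≡u
  ...   | no  v≢u = ⊥-elim (disjoint v u v∈S u∈S v≢u g (v∋g , u∋g))

module _ (G H : Graph) where

  fstV-combine : ∀ g h → fstV G H (combine g h) ≡ g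
  fstV-combine g h = cong proj₁ (remQuot-combine {n G} {n H} g h)

  sndV-combine : ∀ g h → sndV G H (combine g h) ≡ h
  sndV-combine g h = cong proj₂ (remQuot-combine {n G} {n H} g h)

  □-IsRomanDF-combine : ∀ {f} → IsRomanDF (G □ H) f → ∀ g h → val (f (combine g h)) ≡ 0 →
    ∃₂ λ g′ h′ → ((g′ ≡ g × Adj H h h′) ⊎ (Adj G g g′ × h′ ≡ h)) × val (f (combine g′ h′)) ≡ 2
  □-IsRomanDF-combine {f} rdf g h f≡0 with rdf (combine g h) f≡0
  ... | q , q~gh , fq≡2 = fstV G H q , sndV G H q , coordinates q~gh , f[q]≡2
    where
    f[q]≡2 : val (f (combine (fstV G H q) (sndV G H q))) ≡ 2
    f[q]≡2 = ≡.subst (λ p → val (f p) ≡ 2) (≡.sym (combine-remQuot {n G} (n H) q)) fq≡2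
    coordinates : □-Adj G H (combine g h) q →
                  (fstV G H q ≡ g × Adj H h (sndV G H q)) ⊎ (Adj G g (fstV G H q) × sndV G H q ≡ h)
    coordinates (inj₁ (g≡g′ , h~h′)) = inj₁
      (trans (≡.sym g≡g′) (fstV-combine g h) , ≡.subst (λ x → Adj H x _) (sndV-combine g h) h~h′)
    coordinates (inj₂ (g~g′ , h≡h′)) = inj₂
      (≡.subst (λ x → Adj G x _) (fstV-combine g h) g~g′ , trans (≡.sym h≡h′) (sndV-combine g h))

  layer : (Fin (n G * n H) → Fin 3) → Fin (n H) → Fin (n G) → ℕ
  layer f h g = val (f (combine g h))

  collapse : (Fin (n G) → Fin (n G)) → Fin (n G) → (Fin (n G * n H) → Fin 3) → Fin (n H) → Fin 3
  collapse π u f h = clamp₂ (fibreSum π u (layer f h))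

  collapse-IsRomanDF : (π : Fin (n G) → Fin (n G)) {u : Fin (n G)} → (∀ {g} → InN G u g → π g ≡ u) →
                       ∀ {f} → IsRomanDF (G □ H) f → IsRomanDF H (collapse π u f)
  collapse-IsRomanDF π {u} N[u]⊆π⁻¹u {f} rdf h collapse≡0 =
    twoNeighbour (□-IsRomanDF-combine rdf u h f[u,h]≡0)
    where
    ≤fibre : ∀ {g} → InN G u g → ∀ h′ → layer f h′ g ≤ fibreSum π u (layer f h′)
    ≤fibre u∋g h′ = ≤-fibreSum π (layer f h′) (N[u]⊆π⁻¹u u∋g)

    fibre≡0 : fibreSum π u (layer f h) ≡ 0
    fibre≡0 = val-clamp₂≡0 _ collapse≡0

    f[u,h]≡0 : layer f h u ≡ 0
    f[u,h]≡0 = n≤0⇒n≡0 (≡.subst (layer f h u ≤_) fibre≡0 (≤fibre (inj₁ refl) h))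

    twoNeighbour : (∃₂ λ g′ h′ → ((g′ ≡ u × Adj H h h′) ⊎ (Adj G u g′ × h′ ≡ h)) × layer f h′ g′ ≡ 2) →
                   ∃ λ h′ → Adj H h h′ × val (collapse π u f h′) ≡ 2
    twoNeighbour (_ , h′ , inj₁ (refl , h~h′) , f≡2) =
      h′ , h~h′ , val-clamp₂≡2 _ (≡.subst (_≤ fibreSum π u (layer f h′)) f≡2 (≤fibre (inj₁ refl) h′))
    -- g′ ~ u puts (g′, h) in the fibre of u, whose total at h is 0.
    twoNeighbour (g′ , _ , inj₂ (u~g′ , refl) , f≡2)
      with n≤0⇒n≡0 (≡.subst₂ _≤_ f≡2 fibre≡0 (≤fibre (inj₂ u~g′) h))
    ... | ()

module _ (G H : Graph) {S : Subset (n G)} (dom : IsDominating G S)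
         (disjoint : ClosedNeighbourhoodsDisjoint G S) where

  ∣S∣*γR≤weight : ∀ {c} → (∀ f → IsRomanDF H f → c ≤ weight H f) →
                  ∀ {f} → IsRomanDF (G □ H) f → ∣ S ∣ * c ≤ weight (G □ H) f
  ∣S∣*γR≤weight {c} c≤weight {f} rdf = begin
    ∣ S ∣ * c         ≤⟨ ∣p∣*c≤sum S W c≤W ⟩
    sum W             ≡⟨ ≡.sym weight≡sumW ⟩
    weight (G □ H) f  ∎
    where
    open ≤-Reasoning

    π : Fin (n G) → Fin (n G)
    π = proj₁ ∘ dominator G dom

    W : Fin (n G) → ℕ
    W u = ∑[ h < n H ] fibreSum π u (layer G H f h)

    c≤W : ∀ {u} → u ∈ S → c ≤ W u
    c≤W {u} u∈S = begin
      c                               ≤⟨ c≤weight _ collapse-rdf ⟩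
      weight H (collapse G H π u f)   ≡⟨ sum-tabulate (val ∘ collapse G H π u f) ⟩
      sum (val ∘ collapse G H π u f)  ≤⟨ sum-mono-≤ (λ h → val-clamp₂≤ (fibreSum π u (layer G H f h))) ⟩
      W u                             ∎
      where
      collapse-rdf : IsRomanDF H (collapse G H π u f)
      collapse-rdf = collapse-IsRomanDF G H π (dominator-unique G dom disjoint u∈S) rdf

    weight≡sumW : weight (G □ H) f ≡ sum W
    weight≡sumW = begin-equality
      weight (G □ H) f                                  ≡⟨ sum-tabulate (val ∘ f) ⟩
      sum (val ∘ f)                                     ≡⟨ sum-combine (n G) (val ∘ f) ⟩
      ∑[ g < n G ] ∑[ h < n H ] layer G H f h g         ≡⟨ ∑-comm (λ g h → layer G H f h g) ⟩
      ∑[ h < n H ] sum (layer G H f h)                  ≡⟨ sum-cong-≗ (λ h → ≡.sym (sum-fibreSum π (layer G H f h))) ⟩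
      ∑[ h < n H ] ∑[ u < n G ] fibreSum π u (layer G H f h)
                                                        ≡⟨ ∑-comm (λ h u → fibreSum π u (layer G H f h)) ⟩
      sum W                                             ∎

theorem8 : (G H : Graph) → InFrakF G →
    (γG γRH γRGH : ℕ) → IsDomNum G γG → IsRomanDomNum H γRH → IsRomanDomNum (G □ H) γRGH →
      γG * γRH ≤ γRGH
theorem8 G H (_ , _ , S , dom , _ , disjoint) γG γRH γRGH (_ , γG-minimal) (_ , γRH-minimal)
         ((f , rdf , weight≡γRGH) , _) = begin
  γG * γRH          ≤⟨ *-monoˡ-≤ γRH (γG-minimal S dom) ⟩
  ∣ S ∣ * γRH       ≤⟨ ∣S∣*γR≤weight G H dom disjoint γRH-minimal rdf ⟩
  weight (G □ H) f  ≡⟨ weight≡γRGH ⟩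
  γRGH              ∎
  where open ≤-Reasoning
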